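{- Let $\lambda=(\lambda_1,\lambda_2)$ be a strict partition with $\lambda_1>\lambda_2>0$ and $\lambda_1\equiv\lambda_2 \pmod 2$. Let $\sigma=(\sigma_1,\sigma_2)$ be a partition of $\lambda_1+\lambda_2$ into two odd parts with $\sigma_2<\lambda_2$. Then there are exactly two bar tableaux of shape $\lambda$ and type $\sigma$, say $T_1$ and $T_2$, and $wt(T_1)+wt(T_2)=0$.
   Context: For a strict partition $\lambda=(\lambda_1>\dots>\lambda_k>0)$, the shifted diagram $S(\lambda)$ is obtained from the Young diagram of $\lambda$ by shifting the $i$-th row $i-1$ squares to the right. A bar tableau of shape $\lambda$ is a filling of the squares of $S(\lambda)$ by positive integers such that: (1) each row is weakly increasing; (2) for each positive integer $i$ occurring, the number of entries equal to $i$ is odd; (3) each $i$ appears in at most two rows, and if it appears in two rows then both rows begin with $i$; (4) for each $i$, the composition formed by the row lengths after removing all squares with entries larger than $i$ has distinct parts. A bar tableau has type $\rho=(\rho_1,\rho_2,\dots)$ if it contains exactly $\rho_i$ entries equal to $i$ for each $i$. Bars: for an odd positive integer $r$ and $\lambda$ of length $k$ (set $\lambda_{k+1}=0$), let $I_+=\{i:\lambda_{j+1}<\lambda_i-r<\lambda_j$ for some $j\le k\}$, $I_0=\{i:\lambda_i=r\}$, $I_-=\{i: r-\lambda_i=\lambda_j$ for some $j$ with $i<j\le k\}$. For $i\in I_+$ the associated $r$-bar is the rightmost $r$ squares of row $i$ of $S(\lambda)$ and $\lambda(i,r)$ is obtained by replacing $\lambda_i$ with $\lambda_i-r$ (reinserted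 between $\lambda_j$ and $\lambda_{j+1}$); for $i\in I_0$ the $r$-bar is all of row $i$ and $\lambda(i,r)$ removes $\lambda_i$; for $i\in I_-$ the $r$-bar is all of rows $i$ and $j$ and $\lambda(i,r)$ removes $\lambda_i$ and $\lambda_j$. Let $\varepsilon(\lambda)=0$ if $\lambda$ has an even number of even parts and $1$ otherwise. Weight: $wt(\emptyset)=1$; if the squares containing the largest entry of $T$ form the $r$-bar associated with $i\in I_+\cup I_0\cup I_-$ (with $j$ as in the definition), and $T'$ is the bar tableau of shape $\lambda(i,r)$ obtained by removing it, then $wt(T)=n_i\,wt(T')$ where $n_i=(-1)^{j-i}2^{1-\varepsilon(\lambda)}$ if $i\in I_+$, $n_i=(-1)^{\ell(\lambda)-i}$ if $i\in I_0$, and $n_i=(-1)^{j-i+\lambda_i}2^{1-\varepsilon(\lambda)}$ if $i\in I_-$. -}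

module Defs where

open import Data.Nat using (ℕ; zero; suc; _+_; _∸_; _≤_; _<_; _<ᵇ_; _≡ᵇ_; _⊔_; _≟_)
open import Data.Nat.DivMod using (_%_)
open import Data.Bool using (Bool; true; false; if_then_else_; _∧_)
open import Data.Integer as ℤ using (ℤ; +_; -[1+_])
open import Data.List using (List; []; _∷_; length; map; filter; take; drop; _++_; foldr; head)
open import Data.List.Relation.Unary.All using (All)
open import Data.List.Relation.Unary.Linked using (Linked)
open import Data.List.Relation.Unary.Unique.Propositional using (Unique)
open import Data.List.Membership.Propositional using (_∈_)
open import Data.Maybe using (Maybe; just; nothing; map)
open import Data.Product using (_×_)
open import Relation.Nullary.Negation using (¬_)
open import Relation.Binary.PropositionalEquality using (_≡_)

Odd : ℕ → Set
Odd n = n % 2 ≡ 1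

StrictPartition : List ℕ → Set
StrictPartition λs = Linked (λ a b → b < a) λs × All (λ a → 0 < a) λs

-- A filling of a shifted diagram: list of rows (row i = i-th list).
-- Column positions play no role in the conditions, so a filling of
-- S(λ) is a list of rows whose lengths are the parts of λ.
Tableau : Set
Tableau = List (List ℕ)

countRow : ℕ → List ℕ → ℕ
countRow m row = length (filter (m ≟_) row)

count : ℕ → Tableau → ℕ
count m T = foldr (λ row acc → countRow m row + acc) 0 T

rowsContaining : ℕ → Tableau → List (List ℕ)
rowsContaining m T = filter (λ row → m ∈? row) T
  where
  open import Data.List.Membership.DecPropositional _≟_ using (_∈?_)

-- ρ_i (with ρ_i = 0 for i beyond the length of ρ); parts indexed from 1
typeAt : List ℕ → ℕ → ℕ
typeAt ρ zero = 0
typeAt [] (suc i) = 0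
typeAt (a ∷ ρ) (suc zero) = a
typeAt (a ∷ ρ) (suc (suc i)) = typeAt ρ (suc i)

-- lengths of the rows after removing all squares with entries larger than i,
-- keeping only the nonzero ones (a composition has positive parts)
truncLengths : ℕ → Tableau → List ℕ
truncLengths i T =
  filter (λ n → 1 Data.Nat.≤? n) (Data.List.map (λ row → length (filter (λ x → x Data.Nat.≤? i) row)) T)
  where import Data.Nat

record IsBarTableau (λs : List ℕ) (ρ : List ℕ) (T : Tableau) : Set where
  field
    shape      : Data.List.map length T ≡ λs
    positive   : All (All (λ x → 0 < x)) T
    rowsWeak   : All (Linked _≤_) T
    oddCounts  : ∀ i → 0 < count i T → Odd (count i T)
    atMostTwo  : ∀ i → length (rowsContaining i T) ≤ 2
    twoRowsBegin : ∀ i → length (rowsContaining i T) ≡ 2 →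
                   All (λ row → head row ≡ just i) (rowsContaining i T)
    distinctParts : ∀ i → Unique (truncLengths i T)
    hasType    : ∀ i → count (suc i) T ≡ typeAt ρ (suc i)

sgn : ℕ → ℤ
sgn zero = + 1
sgn (suc n) = ℤ.- sgn n

numEven : List ℕ → ℕ
numEven [] = 0
numEven (a ∷ λs) = (if a % 2 ≡ᵇ 0 then 1 else 0) + numEven λs

ε : List ℕ → ℕ
ε λs = numEven λs % 2

-- 2^(1 - ε(λ))
twoPow : List ℕ → ℤ
twoPow λs = if ε λs ≡ᵇ 0 then + 2 else + 1

maxEntry : Tableau → ℕ
maxEntry T = foldr (λ row acc → foldr _⊔_ 0 row ⊔ acc) 0 T

-- 1-based indexing with default
nth : {A : Set} → A → List A → ℕ → A
nth d [] _ = d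
nth d (a ∷ as) zero = d
nth d (a ∷ as) (suc zero) = a
nth d (a ∷ as) (suc (suc i)) = nth d as (suc i)

-- remove the i-th (1-based) element
removeAt : {A : Set} → ℕ → List A → List A
removeAt i xs = take (i ∸ 1) xs ++ drop i xs

-- indices (1-based) of rows containing m, with the number of m's in them
occRows : ℕ → ℕ → Tableau → List (ℕ × ℕ)
occRows m i [] = []
occRows m i (row ∷ T) with countRow m row
... | zero = occRows m (suc i) T
... | suc c = (i Data.Product., suc c) ∷ occRows m (suc i) T

-- the j (1-based, 1 ≤ j ≤ k) with λ_{j+1} < s < λ_j, where λ_{k+1} = 0
slot : ℕ → List ℕ → ℕ → Maybe ℕ
slot s [] j = nothing
slot s (a ∷ rest) j =
  if (nxt rest <ᵇ s) ∧ (s <ᵇ a) then just j else slot s rest (suc j)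
  where
  nxt : List ℕ → ℕ
  nxt [] = 0
  nxt (b ∷ _) = b

-- One bar-removal step for the largest entry m:
-- returns (n_i , T') where T' is the bar tableau of shape λ(i,r),
-- or nothing if the squares containing m do not form an r-bar.
barStep : ℕ → Tableau → Maybe (ℤ × Tableau)
barStep m T = go (occRows m 1 T)
  where
  λs = Data.List.map length T
  k = length λs
  go : List (ℕ × ℕ) → Maybe (ℤ × Tableau)
  go ((i Data.Product., c) ∷ []) =
    let λi = nth 0 λs i
        rowi = nth [] T i in
    if c ≡ᵇ λi
      -- i ∈ I₀ : the bar is all of row i
      then just (sgn (k ∸ i) Data.Product., removeAt i T)
      else (if c <ᵇ λi
        -- i ∈ I₊ : the bar is the rightmost r squares of row i
        then (Data.Maybe.map
               (λ j → (sgn (j ∸ i) ℤ.* twoPow λs) Data.Product.,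
                      (let T⁻ = removeAt i T in
                       take (j ∸ 1) T⁻ ++ (take (λi ∸ c) rowi ∷ drop (j ∸ 1) T⁻)))
               (slot (λi ∸ c) λs 1))
        else nothing)
  -- two rows i < j contain m : must be all of rows i and j (i ∈ I₋)
  go ((i Data.Product., c) ∷ (j Data.Product., d) ∷ []) =
    let λi = nth 0 λs i
        λj = nth 0 λs j in
    if (c ≡ᵇ λi) ∧ (d ≡ᵇ λj)
      then just ((sgn ((j ∸ i) + λi) ℤ.* twoPow λs) Data.Product.,
                 removeAt i (removeAt j T))
      else nothing
  go _ = nothing

-- wtAux m T : weight of T, assuming all entries of T are ≤ m
wtAux : ℕ → Tableau → Maybe ℤ
wtAux zero [] = just (+ 1)
wtAux zero (_ ∷ _) = nothing
wtAux (suc m) T with count (suc m) T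
... | zero = wtAux m T
... | suc _ with barStep (suc m) T
...   | nothing = nothing
...   | just (n Data.Product., T′) = Data.Maybe.map (n ℤ.*_) (wtAux m T′)

-- wt(T); 'nothing' if the recursive definition is not applicable
wt : Tableau → Maybe ℤ
wt T = wtAux (maxEntry T) T

-- Every entry is 1 or 2 and rows increase, so each row is 1^a 2^b.  Condition (3) forbids 2s in
-- both rows (both would have to start with 2, leaving no 1s although σ₁ is odd), so the tableau is
-- T₁ = (1^(λ₁-σ₂) 2^σ₂, 1^λ₂) or T₂ = (1^λ₁, 1^(λ₂-σ₂) 2^σ₂), and both qualify.  In either one,
-- removing the 2s is an I₊ step with factor ±2 (λ₁ ≡ λ₂ mod 2 makes ε(λ) = 0); it leaves two rows
-- of 1s of opposite parity, removed by a single I₋ step with factor ±1.  Tracking the signs gives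
-- wt T₁ = 2·(-1)^λ₁ = -wt T₂, whichever way the shortened first row of T₁ is reinserted.
module Submission where

open import Defs
open import Data.Nat using (ℕ; zero; suc; >-nonZero; _+_; _*_; _∸_; _<_; _≤_; _≟_; _≤?_; z≤n; s≤s; _≡ᵇ_; _<ᵇ_; _⊔_)
open import Data.Nat.Properties
  using (+-identityʳ; +-assoc; +-comm; +-cancelʳ-≡; *-suc; *-identityʳ; ≤-refl; ≤-trans; <-trans;
         <-irrefl; <⇒≤; <⇒≢; <-cmp; m≤m+n; m≤n+m; m<m+n; m<n+m; m∸n+n≡m; m+n∸n≡m; m<n⇒0<n∸m;
         0≢1+n; 1+n≢0; ≡⇒≡ᵇ; <⇒<ᵇ; suc-pred)
open import Data.Nat.DivMod using (_%_; m*n%n≡0)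
open import Data.Bool using (true; false; if_then_else_)
open import Data.Bool.Properties using (T-≡)
open import Data.Integer as ℤ using (ℤ; +_)
open import Data.Integer.Properties using (neg-involutive; neg-distribˡ-*; *-identityˡ; +-inverseʳ)
open import Data.Integer.Tactic.RingSolver using (solve-∀)
open import Data.List using (List; []; _∷_; _++_; replicate; length; filter; take; head; foldr)
open import Data.List.Properties
  using (length-++; length-replicate; filter-++; filter-all; filter-none; filter-some;
         filter-complete; length-filter; ∷-injectiveˡ; ∷-injectiveʳ)
open import Data.List.Membership.Propositional using (_∈_)
open import Data.List.Membership.Propositional.Properties using (∈-++⁺ʳ)
open import Data.List.Membership.DecPropositional _≟_ using (_∈?_)
open import Data.List.Relation.Unary.All as All using (All; []; _∷_)
open import Data.List.Relation.Unary.All.Properties using (replicate⁺; ++⁺; all-filter)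
open import Data.List.Relation.Unary.Any using (here; there)
open import Data.List.Relation.Unary.Linked as Linked using (Linked; []; [-]; _∷_)
open import Data.List.Relation.Unary.Linked.Properties using (Linked⇒All)
open import Data.List.Relation.Unary.AllPairs using ([]; _∷_)
open import Data.List.Relation.Unary.Unique.Propositional using (Unique)
open import Data.Maybe using (just)
import Data.Maybe as Maybe
open import Data.Product using (Σ; _×_; _,_; ∃)
open import Data.Sum using (_⊎_; inj₁; inj₂; [_,_])
open import Data.Empty using (⊥-elim)
open import Function.Bundles using (Equivalence)
open import Relation.Nullary using (¬_; does)
open import Relation.Nullary.Negation using (contradiction)
open import Relation.Unary using (Pred; Decidable)
open import Relation.Binary.PropositionalEquality hiding ([_])
open import Relation.Binary.Definitions using (tri<; tri≈; tri>)

m+o≡p+n⇒m∸n+o≡p : ∀ {m n o p} → n ≤ m → m + o ≡ p + n → m ∸ n + o ≡ p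
m+o≡p+n⇒m∸n+o≡p {m} {n} {o} {p} n≤m eq = +-cancelʳ-≡ n (m ∸ n + o) p (begin
  m ∸ n + o + n    ≡⟨ +-assoc (m ∸ n) o n ⟩
  m ∸ n + (o + n)  ≡⟨ cong (_+_ (m ∸ n)) (+-comm o n) ⟩
  m ∸ n + (n + o)  ≡⟨ sym (+-assoc (m ∸ n) n o) ⟩
  m ∸ n + n + o    ≡⟨ cong (_+ o) (m∸n+n≡m n≤m) ⟩
  m + o            ≡⟨ eq ⟩
  p + n            ∎)
  where open ≡-Reasoning

odd-sum⇒≢ : ∀ {m n} → Odd (m + n) → m ≢ n
odd-sum⇒≢ {m} odd refl = 0≢1+n (trans (sym m+m-even) odd)
  where
  m*2≡m+m : m * 2 ≡ m + m
  m*2≡m+m = trans (*-suc m 1) (cong (_+_ m) (*-identityʳ m))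
  m+m-even : (m + m) % 2 ≡ 0
  m+m-even = subst (λ k → k % 2 ≡ 0) m*2≡m+m (m*n%n≡0 m 2)

≡ᵇ-refl : ∀ m → (m ≡ᵇ m) ≡ true
≡ᵇ-refl m = Equivalence.to T-≡ (≡⇒≡ᵇ m m refl)

≢⇒≡ᵇ-false : ∀ {m n} → m ≢ n → (m ≡ᵇ n) ≡ false
≢⇒≡ᵇ-false {zero} {zero} m≢n = contradiction refl m≢n
≢⇒≡ᵇ-false {zero} {suc n} _ = refl
≢⇒≡ᵇ-false {suc m} {zero} _ = refl
≢⇒≡ᵇ-false {suc m} {suc n} m≢n = ≢⇒≡ᵇ-false (λ m≡n → m≢n (cong suc m≡n))

<⇒<ᵇ-true : ∀ {m n} → m < n → (m <ᵇ n) ≡ true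
<⇒<ᵇ-true m<n = Equivalence.to T-≡ (<⇒<ᵇ m<n)

≤⇒<ᵇ-false : ∀ {m n} → n ≤ m → (m <ᵇ n) ≡ false
≤⇒<ᵇ-false {m} {zero} _ = refl
≤⇒<ᵇ-false {suc m} {suc n} (s≤s n≤m) = ≤⇒<ᵇ-false n≤m

parity : ∀ n → n % 2 ≡ 0 ⊎ n % 2 ≡ 1
parity zero = inj₁ refl
parity (suc zero) = inj₂ refl
parity (suc (suc n)) = parity n

sgn-%2 : ∀ n → sgn n ≡ sgn (n % 2)
sgn-%2 zero = refl
sgn-%2 (suc zero) = refl
sgn-%2 (suc (suc n)) = trans (neg-involutive (sgn n)) (sgn-%2 n)

sgn-parity : ∀ n {p} → n % 2 ≡ p → sgn n ≡ sgn p
sgn-parity n refl = sgn-%2 n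

sgn-+ : ∀ m n → sgn (m + n) ≡ sgn m ℤ.* sgn n
sgn-+ zero n = sym (*-identityˡ (sgn n))
sgn-+ (suc m) n = trans (cong ℤ.-_ (sgn-+ m n)) (neg-distribˡ-* (sgn m) (sgn n))

sgn-+-odd : ∀ m {n} → Odd n → sgn (m + n) ≡ ℤ.- sgn m
sgn-+-odd m {n} odd = begin
  sgn (m + n)          ≡⟨ sgn-+ m n ⟩
  sgn m ℤ.* sgn n      ≡⟨ cong (sgn m ℤ.*_) (sgn-parity n odd) ⟩
  sgn m ℤ.* sgn 1      ≡⟨ times-sgn1 (sgn m) ⟩
  ℤ.- sgn m            ∎
  where
  open ≡-Reasoning
  times-sgn1 : ∀ s → s ℤ.* sgn 1 ≡ ℤ.- s
  times-sgn1 = solve-∀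

-- ε(x ∷ y ∷ []) = 0 exactly when x and y have the same parity, i.e. when sgn x ≡ sgn y.
twoPow-sameSign : ∀ x y {s} → sgn x ≡ s → sgn y ≡ s → twoPow (x ∷ y ∷ []) ≡ + 2
twoPow-sameSign x y refl y≈x with parity x | parity y
... | inj₁ x-even | inj₁ y-even rewrite x-even | y-even = refl
... | inj₂ x-odd  | inj₂ y-odd  rewrite x-odd  | y-odd  = refl
... | inj₁ x-even | inj₂ y-odd
  with () ← trans (sym (sgn-parity x x-even)) (trans (sym y≈x) (sgn-parity y y-odd))
... | inj₂ x-odd  | inj₁ y-even
  with () ← trans (sym (sgn-parity y y-even)) (trans y≈x (sgn-parity x x-odd))

twoPow-oppositeSign : ∀ x y {s} → sgn x ≡ s → sgn y ≡ ℤ.- s → twoPow (x ∷ y ∷ []) ≡ + 1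
twoPow-oppositeSign x y refl y≈-x with parity x | parity y
... | inj₁ x-even | inj₂ y-odd  rewrite x-even | y-odd  = refl
... | inj₂ x-odd  | inj₁ y-even rewrite x-odd  | y-even = refl
... | inj₁ x-even | inj₁ y-even
  with () ← trans (sym (sgn-parity y y-even)) (trans y≈-x (cong ℤ.-_ (sgn-parity x x-even)))
... | inj₂ x-odd  | inj₂ y-odd
  with () ← trans (sym (sgn-parity y y-odd)) (trans y≈-x (cong ℤ.-_ (sgn-parity x x-odd)))

row : ℕ → ℕ → List ℕ
row a b = replicate a 1 ++ replicate b 2

length-row : ∀ a b → length (row a b) ≡ a + b
length-row a b = trans (length-++ (replicate a 1)) (cong₂ _+_ (length-replicate a) (length-replicate b))

length-filter-replicate : ∀ {p} {P : Pred ℕ p} (P? : Decidable P) n x →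
  length (filter P? (replicate n x)) ≡ (if does (P? x) then n else 0)
length-filter-replicate P? zero x with does (P? x)
... | true = refl
... | false = refl
length-filter-replicate P? (suc n) x with does (P? x) | length-filter-replicate P? n x
... | true  | ih = cong suc ih
... | false | ih = ih

length-filter-row : ∀ {p} {P : Pred ℕ p} (P? : Decidable P) a b →
  length (filter P? (row a b)) ≡ (if does (P? 1) then a else 0) + (if does (P? 2) then b else 0)
length-filter-row P? a b = begin
  length (filter P? (row a b))
    ≡⟨ cong length (filter-++ P? (replicate a 1) (replicate b 2)) ⟩
  length (filter P? (replicate a 1) ++ filter P? (replicate b 2))
    ≡⟨ length-++ (filter P? (replicate a 1)) ⟩
  length (filter P? (replicate a 1)) + length (filter P? (replicate b 2))
    ≡⟨ cong₂ _+_ (length-filter-replicate P? a 1) (length-filter-replicate P? b 2) ⟩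
  (if does (P? 1) then a else 0) + (if does (P? 2) then b else 0) ∎
  where open ≡-Reasoning

countRow-row : ∀ m a b → countRow m (row a b) ≡ typeAt (a ∷ b ∷ []) m
countRow-row zero a b = length-filter-row (0 ≟_) a b
countRow-row (suc zero) a b = trans (length-filter-row (1 ≟_) a b) (+-identityʳ a)
countRow-row (suc (suc zero)) a b = length-filter-row (2 ≟_) a b
countRow-row (suc (suc (suc m))) a b = length-filter-row (suc (suc (suc m)) ≟_) a b

count-rows : ∀ m a b c d → count m (row a b ∷ row c d ∷ []) ≡ typeAt (a + c ∷ b + d ∷ []) m
count-rows m a b c d =
  trans (cong₂ _+_ (countRow-row m a b) (trans (+-identityʳ _) (countRow-row m c d))) (typeAt-+ m)
  where
  typeAt-+ : ∀ m → typeAt (a ∷ b ∷ []) m + typeAt (c ∷ d ∷ []) m ≡ typeAt (a + c ∷ b + d ∷ []) m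
  typeAt-+ zero = refl
  typeAt-+ (suc zero) = refl
  typeAt-+ (suc (suc zero)) = refl
  typeAt-+ (suc (suc (suc m))) = refl

row-positive : ∀ a b → All (0 <_) (row a b)
row-positive a b = ++⁺ (replicate⁺ a (s≤s z≤n)) (replicate⁺ b (s≤s z≤n))

replicate-sorted : ∀ n x → Linked _≤_ (replicate n x)
replicate-sorted zero x = []
replicate-sorted (suc zero) x = [-]
replicate-sorted (suc (suc n)) x = ≤-refl ∷ replicate-sorted (suc n) x

row-sorted : ∀ a b → Linked _≤_ (row a b)
row-sorted zero b = replicate-sorted b 2
row-sorted (suc zero) zero = [-]
row-sorted (suc zero) (suc b) = s≤s z≤n ∷ replicate-sorted (suc b) 2
row-sorted (suc (suc a)) b = ≤-refl ∷ row-sorted (suc a) b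

row-head : ∀ {a} b → 0 < a → head (row a b) ≡ just 1
row-head {suc a} b _ = refl

2∈row : ∀ a b → 2 ∈ row a (suc b)
2∈row a b = ∈-++⁺ʳ (replicate a 1) (here refl)

take-row : ∀ a b → take a (row a b) ≡ row a 0
take-row zero zero = refl
take-row zero (suc b) = refl
take-row (suc a) b = cong (1 ∷_) (take-row a b)

OneOrTwo : ℕ → Set
OneOrTwo x = x ≡ 1 ⊎ x ≡ 2

sorted-row : ∀ {r} → All OneOrTwo r → Linked _≤_ r → r ≡ row (countRow 1 r) (countRow 2 r)
sorted-row [] _ = refl
sorted-row (inj₁ refl ∷ r-12) r↑ = cong (1 ∷_) (sorted-row r-12 (Linked.tail r↑))
sorted-row {2 ∷ r} (inj₂ refl ∷ r-12) r↑ =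
  trans (cong (2 ∷_) (trans (sorted-row r-12 (Linked.tail r↑)) (cong (λ a → row a (countRow 2 r)) no-ones)))
        (cong (λ a → row a (countRow 2 (2 ∷ r))) (sym no-ones))
  where
  no-ones : countRow 1 r ≡ 0
  no-ones = cong length (filter-none (1 ≟_)
    (All.map (λ 2≤x 1≡x → <-irrefl 1≡x 2≤x) (All.tail (Linked⇒All ≤-trans ≤-refl r↑))))

-- Bar tableaux of shape (λ₁, λ₂) and type (σ₁, σ₂)

countRow≤count : ∀ {m r T} → r ∈ T → countRow m r ≤ count m T
countRow≤count (here refl) = m≤m+n _ _
countRow≤count {m} {T = r′ ∷ _} (there r∈T) = ≤-trans (countRow≤count r∈T) (m≤n+m _ (countRow m r′))

entries-of-type₂ : ∀ {λs σ₁ σ₂ T} → IsBarTableau λs (σ₁ ∷ σ₂ ∷ []) T → All (All OneOrTwo) T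
entries-of-type₂ {T = T} bt = All.tabulate λ {r} r∈T → All.tabulate λ {x} x∈r →
  entry x (All.lookup (All.lookup positive r∈T) x∈r) (≤-trans (filter-some (x ≟_) x∈r) (countRow≤count r∈T))
  where
  open IsBarTableau bt
  entry : ∀ x → 0 < x → 0 < count x T → OneOrTwo x
  entry (suc zero) _ _ = inj₁ refl
  entry (suc (suc zero)) _ _ = inj₂ refl
  entry (suc (suc (suc k))) _ occurs =
    contradiction (subst (0 <_) (hasType (suc (suc k))) occurs) (<-irrefl refl)

twoRow-form : ∀ {λ₁ λ₂ σ₁ σ₂ T} → IsBarTableau (λ₁ ∷ λ₂ ∷ []) (σ₁ ∷ σ₂ ∷ []) T →
  ∃ λ ((a , b , c , d) : ℕ × ℕ × ℕ × ℕ) → T ≡ row a b ∷ row c d ∷ []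
twoRow-form {T = []} bt with () ← IsBarTableau.shape bt
twoRow-form {T = _ ∷ []} bt with () ← IsBarTableau.shape bt
twoRow-form {T = _ ∷ _ ∷ _ ∷ _} bt with () ← IsBarTableau.shape bt
twoRow-form {T = r₁ ∷ r₂ ∷ []} bt with entries-of-type₂ bt | IsBarTableau.rowsWeak bt
... | r₁-12 ∷ r₂-12 ∷ [] | r₁↑ ∷ r₂↑ ∷ [] =
  (countRow 1 r₁ , countRow 2 r₁ , countRow 1 r₂ , countRow 2 r₂) ,
  cong₂ (λ x y → x ∷ y ∷ []) (sorted-row r₁-12 r₁↑) (sorted-row r₂-12 r₂↑)

rows-sizes : ∀ {λ₁ λ₂ σ₁ σ₂} a b c d →
  IsBarTableau (λ₁ ∷ λ₂ ∷ []) (σ₁ ∷ σ₂ ∷ []) (row a b ∷ row c d ∷ []) →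
  a + b ≡ λ₁ × c + d ≡ λ₂ × a + c ≡ σ₁ × b + d ≡ σ₂
rows-sizes a b c d bt =
    trans (sym (length-row a b)) (∷-injectiveˡ shape)
  , trans (sym (length-row c d)) (∷-injectiveˡ (∷-injectiveʳ shape))
  , trans (sym (count-rows 1 a b c d)) (hasType 0)
  , trans (sym (count-rows 2 a b c d)) (hasType 1)
  where open IsBarTableau bt

twos-in-both-rows : ∀ {λs ρ a b c d} → IsBarTableau λs ρ (row a (suc b) ∷ row c (suc d) ∷ []) →
  a ≡ 0 × c ≡ 0
twos-in-both-rows {a = a} {b} {c} {d} bt =
  starts-with-2 (All.head begins) , starts-with-2 (All.head (All.tail begins))
  where
  open IsBarTableau bt
  both : rowsContaining 2 (row a (suc b) ∷ row c (suc d) ∷ []) ≡ row a (suc b) ∷ row c (suc d) ∷ []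
  both = filter-all (2 ∈?_) (2∈row a b ∷ 2∈row c d ∷ [])
  begins : All (λ r → head r ≡ just 2) (row a (suc b) ∷ row c (suc d) ∷ [])
  begins = subst (All _) both (twoRowsBegin 2 (cong length both))
  starts-with-2 : ∀ {a b} → head (row a b) ≡ just 2 → a ≡ 0
  starts-with-2 {zero} _ = refl

twosInRow₁ twosInRow₂ : ℕ → ℕ → ℕ → Tableau
twosInRow₁ λ₁ λ₂ σ₂ = row (λ₁ ∸ σ₂) σ₂ ∷ row λ₂ 0 ∷ []
twosInRow₂ λ₁ λ₂ σ₂ = row λ₁ 0 ∷ row (λ₂ ∸ σ₂) σ₂ ∷ []

rows-unique : ∀ {λ₁ λ₂ σ₁ σ₂} a b c d → 0 < σ₁ →
  IsBarTableau (λ₁ ∷ λ₂ ∷ []) (σ₁ ∷ σ₂ ∷ []) (row a b ∷ row c d ∷ []) →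
  row a b ∷ row c d ∷ [] ≡ twosInRow₁ λ₁ λ₂ σ₂ ⊎ row a b ∷ row c d ∷ [] ≡ twosInRow₂ λ₁ λ₂ σ₂
rows-unique a zero c d _ bt with rows-sizes a 0 c d bt
... | refl , refl , refl , refl rewrite +-identityʳ a =
  inj₂ (cong (λ x → row a 0 ∷ row x d ∷ []) (sym (m+n∸n≡m c d)))
rows-unique a (suc b) c zero _ bt with rows-sizes a (suc b) c 0 bt
... | refl , refl , refl , refl rewrite +-identityʳ c | +-identityʳ b =
  inj₁ (cong (λ x → row x (suc b) ∷ row c 0 ∷ []) (sym (m+n∸n≡m a (suc b))))
rows-unique a (suc b) c (suc d) 0<σ₁ bt with twos-in-both-rows bt | rows-sizes a (suc b) c (suc d) bt
... | refl , refl | _ , _ , refl , _ = contradiction 0<σ₁ (<-irrefl refl)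

barTableau-unique : ∀ {λ₁ λ₂ σ₁ σ₂} T → 0 < σ₁ → IsBarTableau (λ₁ ∷ λ₂ ∷ []) (σ₁ ∷ σ₂ ∷ []) T →
  T ≡ twosInRow₁ λ₁ λ₂ σ₂ ⊎ T ≡ twosInRow₂ λ₁ λ₂ σ₂
barTableau-unique T 0<σ₁ bt with twoRow-form bt
... | (a , b , c , d) , refl = rows-unique a b c d 0<σ₁ bt

unique-nonzero-pair : ∀ x y → (x ≡ y → x ≡ 0) → Unique (filter (1 ≤?_) (x ∷ y ∷ []))
unique-nonzero-pair zero zero _ = []
unique-nonzero-pair zero (suc y) _ = [] ∷ []
unique-nonzero-pair (suc x) zero _ = [] ∷ []
unique-nonzero-pair (suc x) (suc y) x≡y⇒x≡0 = ((λ x≡y → 1+n≢0 (x≡y⇒x≡0 x≡y)) ∷ []) ∷ [] ∷ []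

rows-twoRowsBegin : ∀ {a b c d} → b ≡ 0 ⊎ d ≡ 0 → ∀ m →
  length (rowsContaining m (row a b ∷ row c d ∷ [])) ≡ 2 →
  All (λ r → head r ≡ just m) (rowsContaining m (row a b ∷ row c d ∷ []))
rows-twoRowsBegin {a} {b} {c} {d} twos-in-one-row m two =
  subst (All _) (sym all-rows)
        (begin-with m (occurs (All.head contain)) (occurs (All.head (All.tail contain))))
  where
  T = row a b ∷ row c d ∷ []
  all-rows : rowsContaining m T ≡ T
  all-rows = filter-complete (m ∈?_) two
  contain : All (m ∈_) T
  contain = subst (All (m ∈_)) all-rows (all-filter (m ∈?_) T)
  occurs : ∀ {x y} → m ∈ row x y → 0 < typeAt (x ∷ y ∷ []) m
  occurs {x} {y} m∈r = subst (0 <_) (countRow-row m x y) (filter-some (m ≟_) m∈r)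
  begin-with : ∀ m → 0 < typeAt (a ∷ b ∷ []) m → 0 < typeAt (c ∷ d ∷ []) m → All (λ r → head r ≡ just m) T
  begin-with (suc zero) 0<a 0<c = row-head b 0<a ∷ row-head d 0<c ∷ []
  begin-with (suc (suc zero)) 0<b 0<d =
    ⊥-elim ([ (λ b≡0 → <-irrefl (sym b≡0) 0<b) , (λ d≡0 → <-irrefl (sym d≡0) 0<d) ] twos-in-one-row)

rows-distinctParts : ∀ {a b c d} → a ≢ c → a + b ≢ c + d →
  ∀ m → Unique (truncLengths m (row a b ∷ row c d ∷ []))
rows-distinctParts {a} {b} {c} {d} a≢c a+b≢c+d m = unique-nonzero-pair _ _ (equal⇒zero m)
  where
  equal⇒zero : ∀ m → length (filter (_≤? m) (row a b)) ≡ length (filter (_≤? m) (row c d)) →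
    length (filter (_≤? m) (row a b)) ≡ 0
  equal⇒zero zero _ = length-filter-row (_≤? 0) a b
  equal⇒zero (suc zero) eq = contradiction
    (+-cancelʳ-≡ 0 a c (trans (sym (length-filter-row (_≤? 1) a b)) (trans eq (length-filter-row (_≤? 1) c d))))
    a≢c
  equal⇒zero (suc (suc m)) eq = contradiction
    (trans (sym (length-filter-row (_≤? 2 + m) a b)) (trans eq (length-filter-row (_≤? 2 + m) c d)))
    a+b≢c+d

rows-isBarTableau : ∀ {λ₁ λ₂ σ₁ σ₂ a b c d} → a + b ≡ λ₁ → c + d ≡ λ₂ → a + c ≡ σ₁ → b + d ≡ σ₂ →
  Odd σ₁ → Odd σ₂ → λ₁ ≢ λ₂ → b ≡ 0 ⊎ d ≡ 0 →
  IsBarTableau (λ₁ ∷ λ₂ ∷ []) (σ₁ ∷ σ₂ ∷ []) (row a b ∷ row c d ∷ [])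
rows-isBarTableau {a = a} {b} {c} {d} refl refl refl refl odd₁ odd₂ λ₁≢λ₂ twos-in-one-row = record
  { shape = cong₂ (λ x y → x ∷ y ∷ []) (length-row a b) (length-row c d)
  ; positive = row-positive a b ∷ row-positive c d ∷ []
  ; rowsWeak = row-sorted a b ∷ row-sorted c d ∷ []
  ; oddCounts = λ m occurs →
      subst Odd (sym (count-rows m a b c d)) (odd-type m (subst (0 <_) (count-rows m a b c d) occurs))
  ; atMostTwo = λ m → length-filter (m ∈?_) (row a b ∷ row c d ∷ [])
  ; twoRowsBegin = rows-twoRowsBegin {a} {b} {c} {d} twos-in-one-row
  ; distinctParts = rows-distinctParts {a} {b} {c} {d} (odd-sum⇒≢ odd₁) λ₁≢λ₂
  ; hasType = λ m → count-rows (suc m) a b c d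
  }
  where
  odd-type : ∀ m → 0 < typeAt (a + c ∷ b + d ∷ []) m → Odd (typeAt (a + c ∷ b + d ∷ []) m)
  odd-type (suc zero) _ = odd₁
  odd-type (suc (suc zero)) _ = odd₂

-- Weights

occRows-skip : ∀ m i r T → countRow m r ≡ 0 → occRows m i (r ∷ T) ≡ occRows m (suc i) T
occRows-skip m i r T none rewrite none = refl

occRows-hit : ∀ m i r T {c} → countRow m r ≡ suc c → occRows m i (r ∷ T) ≡ (i , suc c) ∷ occRows m (suc i) T
occRows-hit m i r T some rewrite some = refl

-- sgn 0 and sgn 1 below are (-1)^(j-i): the I₊ step reinserts the shortened row i as row j.
barStep-twosBelow : ∀ A C b → 0 < C →
  barStep 2 (row A 0 ∷ row C (suc b) ∷ []) ≡
    just (sgn 0 ℤ.* twoPow (A ∷ C + suc b ∷ []) , row A 0 ∷ row C 0 ∷ [])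
barStep-twosBelow A C b 0<C
  rewrite occRows-skip 2 1 (row A 0) (row C (suc b) ∷ []) (countRow-row 2 A 0)
        | occRows-hit 2 2 (row C (suc b)) [] (countRow-row 2 C (suc b))
        | length-row C (suc b) | length-row A 0 | +-identityʳ A | m+n∸n≡m C (suc b)
        | ≢⇒≡ᵇ-false (<⇒≢ (m<n+m (suc b) 0<C))
        | <⇒<ᵇ-true (m<n+m (suc b) 0<C)
        | ≤⇒<ᵇ-false (m≤m+n C (suc b))
        | <⇒<ᵇ-true 0<C
        | <⇒<ᵇ-true (m<m+n C {suc b} (s≤s z≤n))
        | take-row C (suc b) = refl

barStep-twosAbove-stays : ∀ D L b → 0 < D → L < D →
  barStep 2 (row D (suc b) ∷ row L 0 ∷ []) ≡
    just (sgn 0 ℤ.* twoPow (D + suc b ∷ L ∷ []) , row D 0 ∷ row L 0 ∷ [])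
barStep-twosAbove-stays D L b 0<D L<D
  rewrite occRows-hit 2 1 (row D (suc b)) (row L 0 ∷ []) (countRow-row 2 D (suc b))
        | occRows-skip 2 2 (row L 0) [] (countRow-row 2 L 0)
        | length-row D (suc b) | length-row L 0 | +-identityʳ L | m+n∸n≡m D (suc b)
        | ≢⇒≡ᵇ-false (<⇒≢ (m<n+m (suc b) 0<D))
        | <⇒<ᵇ-true (m<n+m (suc b) 0<D)
        | <⇒<ᵇ-true L<D
        | <⇒<ᵇ-true (m<m+n D {suc b} (s≤s z≤n))
        | take-row D (suc b) = refl

barStep-twosAbove-drops : ∀ D L b → 0 < D → D < L →
  barStep 2 (row D (suc b) ∷ row L 0 ∷ []) ≡
    just (sgn 1 ℤ.* twoPow (D + suc b ∷ L ∷ []) , row L 0 ∷ row D 0 ∷ [])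
barStep-twosAbove-drops D L b 0<D D<L
  rewrite occRows-hit 2 1 (row D (suc b)) (row L 0 ∷ []) (countRow-row 2 D (suc b))
        | occRows-skip 2 2 (row L 0) [] (countRow-row 2 L 0)
        | length-row D (suc b) | length-row L 0 | +-identityʳ L | m+n∸n≡m D (suc b)
        | ≢⇒≡ᵇ-false (<⇒≢ (m<n+m (suc b) 0<D))
        | <⇒<ᵇ-true (m<n+m (suc b) 0<D)
        | ≤⇒<ᵇ-false (<⇒≤ D<L)
        | <⇒<ᵇ-true 0<D
        | <⇒<ᵇ-true D<L
        | take-row D (suc b) = refl

barStep-ones : ∀ P Q → 0 < P → 0 < Q →
  barStep 1 (row P 0 ∷ row Q 0 ∷ []) ≡ just (sgn (1 + P) ℤ.* twoPow (P ∷ Q ∷ []) , [])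
barStep-ones P Q 0<P 0<Q
  rewrite occRows-hit 1 1 (row P 0) (row Q 0 ∷ [])
            (trans (countRow-row 1 P 0) (sym (suc-pred P {{>-nonZero 0<P}})))
        | occRows-hit 1 2 (row Q 0) [] (trans (countRow-row 1 Q 0) (sym (suc-pred Q {{>-nonZero 0<Q}})))
        | length-row P 0 | length-row Q 0 | +-identityʳ P | +-identityʳ Q
        | suc-pred P {{>-nonZero 0<P}} | suc-pred Q {{>-nonZero 0<Q}} | ≡ᵇ-refl P | ≡ᵇ-refl Q = refl

wtAux-step : ∀ m T {n T′} → 0 < count (suc m) T → barStep (suc m) T ≡ just (n , T′) →
  wtAux (suc m) T ≡ Maybe.map (n ℤ.*_) (wtAux m T′)
wtAux-step m T occurs step with count (suc m) T | occurs
... | suc _ | _ rewrite step = refl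

max-row-ones : ∀ a → foldr _⊔_ 0 (row (suc a) 0) ≡ 1
max-row-ones zero = refl
max-row-ones (suc a) = cong (1 ⊔_) (max-row-ones a)

max-replicate-twos : ∀ b → foldr _⊔_ 0 (replicate (suc b) 2) ≡ 2
max-replicate-twos zero = refl
max-replicate-twos (suc b) = cong (2 ⊔_) (max-replicate-twos b)

max-row-twos : ∀ a b → foldr _⊔_ 0 (row a (suc b)) ≡ 2
max-row-twos zero b = max-replicate-twos b
max-row-twos (suc a) b = cong (1 ⊔_) (max-row-twos a b)

wt-twoBars : ∀ T {n} P Q → maxEntry T ≡ 2 → 0 < count 2 T →
  barStep 2 T ≡ just (n , row P 0 ∷ row Q 0 ∷ []) → 0 < P → 0 < Q →
  wt T ≡ just (n ℤ.* (sgn (1 + P) ℤ.* twoPow (P ∷ Q ∷ []) ℤ.* + 1))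
wt-twoBars T {n} P Q max≡2 twos step 0<P 0<Q = begin
  wtAux (maxEntry T) T
    ≡⟨ cong (λ m → wtAux m T) max≡2 ⟩
  wtAux 2 T
    ≡⟨ wtAux-step 1 T twos step ⟩
  Maybe.map (n ℤ.*_) (wtAux 1 (row P 0 ∷ row Q 0 ∷ []))
    ≡⟨ cong (Maybe.map (n ℤ.*_)) (wtAux-step 0 (row P 0 ∷ row Q 0 ∷ []) ones (barStep-ones P Q 0<P 0<Q)) ⟩
  just (n ℤ.* (sgn (1 + P) ℤ.* twoPow (P ∷ Q ∷ []) ℤ.* + 1)) ∎
  where
  open ≡-Reasoning
  ones : 0 < count 1 (row P 0 ∷ row Q 0 ∷ [])
  ones = subst (0 <_) (sym (count-rows 1 P 0 Q 0)) (≤-trans 0<P (m≤m+n P Q))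

wt-twosBelow : ∀ A C B → 0 < A → 0 < C → 0 < B →
  wt (row A 0 ∷ row C B ∷ []) ≡
    just (sgn 0 ℤ.* twoPow (A ∷ C + B ∷ []) ℤ.* (sgn (1 + A) ℤ.* twoPow (A ∷ C ∷ []) ℤ.* + 1))
wt-twosBelow (suc a) C (suc b) 0<A 0<C _ =
  wt-twoBars (row (suc a) 0 ∷ row C (suc b) ∷ []) (suc a) C
             (cong₂ (λ x y → x ⊔ (y ⊔ 0)) (max-row-ones a) (max-row-twos C b))
             (subst (0 <_) (sym (count-rows 2 (suc a) 0 C (suc b))) (s≤s z≤n))
             (barStep-twosBelow (suc a) C b 0<C) 0<A 0<C

wt-twosAbove-stays : ∀ D L B → 0 < D → 0 < L → 0 < B → L < D →
  wt (row D B ∷ row L 0 ∷ []) ≡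
    just (sgn 0 ℤ.* twoPow (D + B ∷ L ∷ []) ℤ.* (sgn (1 + D) ℤ.* twoPow (D ∷ L ∷ []) ℤ.* + 1))
wt-twosAbove-stays D (suc l) (suc b) 0<D 0<L _ L<D =
  wt-twoBars (row D (suc b) ∷ row (suc l) 0 ∷ []) D (suc l)
             (cong₂ (λ x y → x ⊔ (y ⊔ 0)) (max-row-twos D b) (max-row-ones l))
             (subst (0 <_) (sym (count-rows 2 D (suc b) (suc l) 0)) (s≤s z≤n))
             (barStep-twosAbove-stays D (suc l) b 0<D L<D) 0<D 0<L

wt-twosAbove-drops : ∀ D L B → 0 < D → 0 < B → D < L →
  wt (row D B ∷ row L 0 ∷ []) ≡
    just (sgn 1 ℤ.* twoPow (D + B ∷ L ∷ []) ℤ.* (sgn (1 + L) ℤ.* twoPow (L ∷ D ∷ []) ℤ.* + 1))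
wt-twosAbove-drops D (suc l) (suc b) 0<D _ D<L =
  wt-twoBars (row D (suc b) ∷ row (suc l) 0 ∷ []) (suc l) D
             (cong₂ (λ x y → x ⊔ (y ⊔ 0)) (max-row-twos D b) (max-row-ones l))
             (subst (0 <_) (sym (count-rows 2 D (suc b) (suc l) 0)) (s≤s z≤n))
             (barStep-twosAbove-drops D (suc l) b 0<D D<L) (s≤s z≤n) 0<D

odd⇒pos : ∀ {n} → Odd n → 0 < n
odd⇒pos {suc n} _ = s≤s z≤n

twosInRow₁≢twosInRow₂ : ∀ {λ₁ λ₂ σ₂} → 0 < σ₂ → twosInRow₁ λ₁ λ₂ σ₂ ≢ twosInRow₂ λ₁ λ₂ σ₂
twosInRow₁≢twosInRow₂ {λ₁} {λ₂} {σ₂} 0<σ₂ eq = <-irrefl (sym σ₂≡0) 0<σ₂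
  where
  σ₂≡0 : σ₂ ≡ 0
  σ₂≡0 = begin
    σ₂                                   ≡⟨ sym (countRow-row 2 (λ₁ ∸ σ₂) σ₂) ⟩
    countRow 2 (row (λ₁ ∸ σ₂) σ₂)        ≡⟨ cong (countRow 2) (∷-injectiveˡ eq) ⟩
    countRow 2 (row λ₁ 0)                ≡⟨ countRow-row 2 λ₁ 0 ⟩
    0                                    ∎
    where open ≡-Reasoning

module TwoRowShape {λ₁ λ₂ σ₁ σ₂ : ℕ} (λ₂<λ₁ : λ₂ < λ₁) (0<λ₂ : 0 < λ₂) (same-parity : λ₁ % 2 ≡ λ₂ % 2)
                   (odd₁ : Odd σ₁) (odd₂ : Odd σ₂) (sizes : σ₁ + σ₂ ≡ λ₁ + λ₂) (σ₂<λ₂ : σ₂ < λ₂) where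

  private
    σ₂≤λ₂ : σ₂ ≤ λ₂
    σ₂≤λ₂ = <⇒≤ σ₂<λ₂

    σ₂≤λ₁ : σ₂ ≤ λ₁
    σ₂≤λ₁ = <⇒≤ (<-trans σ₂<λ₂ λ₂<λ₁)

    λ₁≢λ₂ : λ₁ ≢ λ₂
    λ₁≢λ₂ λ₁≡λ₂ = <⇒≢ λ₂<λ₁ (sym λ₁≡λ₂)

    first-rest : λ₁ ∸ σ₂ + λ₂ ≡ σ₁
    first-rest = m+o≡p+n⇒m∸n+o≡p σ₂≤λ₁ (sym sizes)

    second-rest : λ₁ + (λ₂ ∸ σ₂) ≡ σ₁
    second-rest = trans (+-comm λ₁ (λ₂ ∸ σ₂)) (m+o≡p+n⇒m∸n+o≡p σ₂≤λ₂ (trans (+-comm λ₂ λ₁) (sym sizes)))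

    sgn-λ₂ : sgn λ₂ ≡ sgn λ₁
    sgn-λ₂ = trans (sgn-parity λ₂ (sym same-parity)) (sym (sgn-%2 λ₁))

    sgn-∸σ₂ : ∀ {n} → σ₂ ≤ n → sgn (n ∸ σ₂) ≡ ℤ.- sgn n
    sgn-∸σ₂ {n} σ₂≤n = begin
      sgn (n ∸ σ₂)                  ≡⟨ sym (neg-involutive _) ⟩
      ℤ.- ℤ.- sgn (n ∸ σ₂)          ≡⟨ cong ℤ.-_ (sym (sgn-+-odd (n ∸ σ₂) odd₂)) ⟩
      ℤ.- sgn (n ∸ σ₂ + σ₂)         ≡⟨ cong (λ k → ℤ.- sgn k) (m∸n+n≡m σ₂≤n) ⟩
      ℤ.- sgn n                     ∎
      where open ≡-Reasoning

    D C : ℕ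
    D = λ₁ ∸ σ₂
    C = λ₂ ∸ σ₂

    0<D : 0 < D
    0<D = m<n⇒0<n∸m (<-trans σ₂<λ₂ λ₂<λ₁)

    sgn-D : sgn D ≡ ℤ.- sgn λ₁
    sgn-D = sgn-∸σ₂ σ₂≤λ₁

    sgn-C : sgn C ≡ ℤ.- sgn λ₁
    sgn-C = trans (sgn-∸σ₂ σ₂≤λ₂) (cong ℤ.-_ sgn-λ₂)

    sgn-D+σ₂ : sgn (D + σ₂) ≡ sgn λ₁
    sgn-D+σ₂ = cong sgn (m∸n+n≡m σ₂≤λ₁)

    sgn-C+σ₂ : sgn (C + σ₂) ≡ sgn λ₁
    sgn-C+σ₂ = trans (cong sgn (m∸n+n≡m σ₂≤λ₂)) sgn-λ₂

    wt-twosInRow₁-drops : D < λ₂ → wt (twosInRow₁ λ₁ λ₂ σ₂) ≡ just (+ 2 ℤ.* sgn λ₁)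
    wt-twosInRow₁-drops D<λ₂ =
      trans (wt-twosAbove-drops D λ₂ σ₂ 0<D (odd⇒pos odd₂) D<λ₂) (cong just (begin
      sgn 1 ℤ.* twoPow (D + σ₂ ∷ λ₂ ∷ []) ℤ.* (sgn (1 + λ₂) ℤ.* twoPow (λ₂ ∷ D ∷ []) ℤ.* + 1)
        ≡⟨ cong₂ (λ u v → sgn 1 ℤ.* u ℤ.* (sgn (1 + λ₂) ℤ.* v ℤ.* + 1))
                 (twoPow-sameSign (D + σ₂) λ₂ sgn-D+σ₂ sgn-λ₂) (twoPow-oppositeSign λ₂ D sgn-λ₂ sgn-D) ⟩
      sgn 1 ℤ.* + 2 ℤ.* (ℤ.- sgn λ₂ ℤ.* + 1 ℤ.* + 1)
        ≡⟨ cong (λ t → sgn 1 ℤ.* + 2 ℤ.* (ℤ.- t ℤ.* + 1 ℤ.* + 1)) sgn-λ₂ ⟩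
      sgn 1 ℤ.* + 2 ℤ.* (ℤ.- sgn λ₁ ℤ.* + 1 ℤ.* + 1)
        ≡⟨ normalise (sgn λ₁) ⟩
      + 2 ℤ.* sgn λ₁ ∎))
      where
      open ≡-Reasoning
      normalise : ∀ s → sgn 1 ℤ.* + 2 ℤ.* (ℤ.- s ℤ.* + 1 ℤ.* + 1) ≡ + 2 ℤ.* s
      normalise = solve-∀

    wt-twosInRow₁-stays : λ₂ < D → wt (twosInRow₁ λ₁ λ₂ σ₂) ≡ just (+ 2 ℤ.* sgn λ₁)
    wt-twosInRow₁-stays λ₂<D =
      trans (wt-twosAbove-stays D λ₂ σ₂ 0<D 0<λ₂ (odd⇒pos odd₂) λ₂<D) (cong just (begin
      sgn 0 ℤ.* twoPow (D + σ₂ ∷ λ₂ ∷ []) ℤ.* (sgn (1 + D) ℤ.* twoPow (D ∷ λ₂ ∷ []) ℤ.* + 1)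
        ≡⟨ cong₂ (λ u v → sgn 0 ℤ.* u ℤ.* (sgn (1 + D) ℤ.* v ℤ.* + 1))
                 (twoPow-sameSign (D + σ₂) λ₂ sgn-D+σ₂ sgn-λ₂)
                 (twoPow-oppositeSign D λ₂ sgn-D (trans sgn-λ₂ (sym (neg-involutive (sgn λ₁))))) ⟩
      sgn 0 ℤ.* + 2 ℤ.* (ℤ.- sgn D ℤ.* + 1 ℤ.* + 1)
        ≡⟨ cong (λ t → sgn 0 ℤ.* + 2 ℤ.* (ℤ.- t ℤ.* + 1 ℤ.* + 1)) sgn-D ⟩
      sgn 0 ℤ.* + 2 ℤ.* (ℤ.- ℤ.- sgn λ₁ ℤ.* + 1 ℤ.* + 1)
        ≡⟨ normalise (sgn λ₁) ⟩
      + 2 ℤ.* sgn λ₁ ∎))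
      where
      open ≡-Reasoning
      normalise : ∀ s → sgn 0 ℤ.* + 2 ℤ.* (ℤ.- ℤ.- s ℤ.* + 1 ℤ.* + 1) ≡ + 2 ℤ.* s
      normalise = solve-∀

  twosInRow₁-isBarTableau : IsBarTableau (λ₁ ∷ λ₂ ∷ []) (σ₁ ∷ σ₂ ∷ []) (twosInRow₁ λ₁ λ₂ σ₂)
  twosInRow₁-isBarTableau =
    rows-isBarTableau (m∸n+n≡m σ₂≤λ₁) (+-identityʳ λ₂) first-rest (+-identityʳ σ₂) odd₁ odd₂ λ₁≢λ₂ (inj₂ refl)

  twosInRow₂-isBarTableau : IsBarTableau (λ₁ ∷ λ₂ ∷ []) (σ₁ ∷ σ₂ ∷ []) (twosInRow₂ λ₁ λ₂ σ₂)
  twosInRow₂-isBarTableau =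
    rows-isBarTableau (+-identityʳ λ₁) (m∸n+n≡m σ₂≤λ₂) second-rest refl odd₁ odd₂ λ₁≢λ₂ (inj₁ refl)

  -- D ≢ λ₂ because D + λ₂ = σ₁ is odd; which one is larger decides where the I₊ step reinserts row 1.
  wt-twosInRow₁ : wt (twosInRow₁ λ₁ λ₂ σ₂) ≡ just (+ 2 ℤ.* sgn λ₁)
  wt-twosInRow₁ with <-cmp D λ₂
  ... | tri< D<λ₂ _ _ = wt-twosInRow₁-drops D<λ₂
  ... | tri≈ _ D≡λ₂ _ = contradiction D≡λ₂ (odd-sum⇒≢ (subst Odd (sym first-rest) odd₁))
  ... | tri> _ _ λ₂<D = wt-twosInRow₁-stays λ₂<D

  wt-twosInRow₂ : wt (twosInRow₂ λ₁ λ₂ σ₂) ≡ just (ℤ.- (+ 2 ℤ.* sgn λ₁))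
  wt-twosInRow₂ =
    trans (wt-twosBelow λ₁ C σ₂ (<-trans 0<λ₂ λ₂<λ₁) (m<n⇒0<n∸m σ₂<λ₂) (odd⇒pos odd₂)) (cong just (begin
    sgn 0 ℤ.* twoPow (λ₁ ∷ C + σ₂ ∷ []) ℤ.* (sgn (1 + λ₁) ℤ.* twoPow (λ₁ ∷ C ∷ []) ℤ.* + 1)
      ≡⟨ cong₂ (λ u v → sgn 0 ℤ.* u ℤ.* (sgn (1 + λ₁) ℤ.* v ℤ.* + 1))
               (twoPow-sameSign λ₁ (C + σ₂) refl sgn-C+σ₂) (twoPow-oppositeSign λ₁ C refl sgn-C) ⟩
    sgn 0 ℤ.* + 2 ℤ.* (ℤ.- sgn λ₁ ℤ.* + 1 ℤ.* + 1)
      ≡⟨ normalise (sgn λ₁) ⟩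
    ℤ.- (+ 2 ℤ.* sgn λ₁) ∎))
    where
    open ≡-Reasoning
    normalise : ∀ s → sgn 0 ℤ.* + 2 ℤ.* (ℤ.- s ℤ.* + 1 ℤ.* + 1) ≡ ℤ.- (+ 2 ℤ.* s)
    normalise = solve-∀

mainTheorem2 : (λ₁ λ₂ σ₁ σ₂ : ℕ) →
    λ₂ < λ₁ → 0 < λ₂ → λ₁ % 2 ≡ λ₂ % 2 →
    σ₂ ≤ σ₁ → Odd σ₁ → Odd σ₂ → σ₁ + σ₂ ≡ λ₁ + λ₂ → σ₂ < λ₂ →
    Σ Tableau λ T₁ → Σ Tableau λ T₂ →
    IsBarTableau (λ₁ ∷ λ₂ ∷ []) (σ₁ ∷ σ₂ ∷ []) T₁ ×
    IsBarTableau (λ₁ ∷ λ₂ ∷ []) (σ₁ ∷ σ₂ ∷ []) T₂ ×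
    ¬ (T₁ ≡ T₂) ×
    (∀ T → IsBarTableau (λ₁ ∷ λ₂ ∷ []) (σ₁ ∷ σ₂ ∷ []) T → (T ≡ T₁) ⊎ (T ≡ T₂)) ×
    Σ ℤ λ w₁ → Σ ℤ λ w₂ → wt T₁ ≡ just w₁ × wt T₂ ≡ just w₂ × w₁ ℤ.+ w₂ ≡ ℤ.+ 0
mainTheorem2 λ₁ λ₂ σ₁ σ₂ λ₂<λ₁ 0<λ₂ same-parity _ odd₁ odd₂ sizes σ₂<λ₂ =
  twosInRow₁ λ₁ λ₂ σ₂ , twosInRow₂ λ₁ λ₂ σ₂ ,
  twosInRow₁-isBarTableau , twosInRow₂-isBarTableau , twosInRow₁≢twosInRow₂ (odd⇒pos {σ₂} odd₂) ,
  (λ T bt → barTableau-unique T (odd⇒pos odd₁) bt) ,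
  + 2 ℤ.* sgn λ₁ , ℤ.- (+ 2 ℤ.* sgn λ₁) , wt-twosInRow₁ , wt-twosInRow₂ , +-inverseʳ (+ 2 ℤ.* sgn λ₁)
  where open TwoRowShape {λ₁} {λ₂} {σ₁} {σ₂} λ₂<λ₁ 0<λ₂ same-parity odd₁ odd₂ sizes σ₂<λ₂
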